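{- For every index $i$ such that $A_i$ is infinite, there exists $n\geq 1$ such that $\lim_y\lim_k\lim_s I(n,y,k,s)=i$.
   Context: $\mu(x)$ is the largest exponent in the binary expansion of $x\in\mathbb{Z}^+$, $B^n=\{x\in\mathbb{Z}^+:\mu(x)=n\}$. Let $W_e$ be the $e$-th r.e. set with stage-$s$ approximation $W_{e,s}$; let $\Phi_i(x,y)$ be the $i$-th $\Sigma^0_2$ formula and $g$ total recursive with $\Phi_i(x,y)\iff W_{g(i,x,y)}$ finite. Set $F(i,x,y,s)=\max_{y'\leq y}|W_{g(i,x,y'),s}|$, $A_i=\{x:\forall y\ \lim_s F(i,x,y,s)<\infty\}$ (these are exactly the $\Pi^0_3$ sets), and $B(i,n,y,s)=\min\{F(i,x,y,s):x\in B^n\}$. The function $I(n,y,k,s)\in\mathbb{N}\cup\{\infty\}$ is defined for $0<n<y\leq k\leq s$ by recursion on $n$: $I(n,y,k,s)=\min\big(\{i<n: B(i,n,y,s)<k \text{ and } I(m,y,k,s)\neq i \text{ for all } 1\leq m<n\}\cup\{\infty\}\big)$. Limits are as the variable tends to infinity, with values in $\mathbb{N}\cup\{\infty\}$. -}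

module Defs where

open import Level using (0ℓ)
open import Data.Nat using (ℕ; zero; suc; _+_; _^_; _≤_; _<_; _⊔_; _⊓_; _<ᵇ_; _≡ᵇ_)
open import Data.Bool using (Bool; true; false; if_then_else_; _∧_; not)
open import Data.List using (List; []; _∷_; _++_; foldr; upTo; applyUpTo; map)
open import Data.Nat.ListAction using (sum)
open import Data.Bool.ListAction using (any)
open import Data.Product using (∃; _×_)
open import Data.Sum using (_⊎_)
open import Relation.Binary.PropositionalEquality using (_≡_)

data ℕ∞ : Set where
  fin : ℕ → ℕ∞
  ∞   : ℕ∞

_==∞_ : ℕ∞ → ℕ∞ → Bool
fin a ==∞ fin b = a ≡ᵇ b
∞     ==∞ ∞     = true
_     ==∞ _     = false

Eventually : (ℕ → Set) → Set
Eventually P = ∃ λ S → ∀ s → S ≤ s → P s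

-- lim_s f(s) = v  for ℕ∪{∞}-valued f (finite points are isolated)
LimIs : (ℕ → ℕ∞) → ℕ∞ → Set
LimIs f (fin a) = Eventually (λ s → f s ≡ fin a)
LimIs f ∞       = ∀ N → Eventually (λ s → f s ≡ ∞ ⊎ (∃ λ b → f s ≡ fin b × N ≤ b))

LimIsℕ : (ℕ → ℕ) → ℕ∞ → Set
LimIsℕ f v = LimIs (λ s → fin (f s)) v

-- Stage approximations of the r.e. sets.
-- W e s x = true  means  x ∈ W_{e,s}.  Standard conventions:
-- W_{e,s} ⊆ [0,s) (so it is finite) and W_{e,s} ⊆ W_{e,s+1}.

record IsStageApprox (W : ℕ → ℕ → ℕ → Bool) : Set where
  field
    bounded : ∀ e s x → W e s x ≡ true → x < s
    mono    : ∀ e s x → W e s x ≡ true → W e (suc s) x ≡ true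

maxUpTo : (ℕ → ℕ) → ℕ → ℕ
maxUpTo f zero    = f zero
maxUpTo f (suc y) = maxUpTo f y ⊔ f (suc y)

-- minimum of a list (only used on non-empty lists)
minList : List ℕ → ℕ
minList []       = 0
minList (x ∷ xs) = foldr _⊓_ x xs

leastBelow : ℕ → (ℕ → Bool) → ℕ∞
leastBelow zero    p = ∞
leastBelow (suc n) p with leastBelow n p
... | fin j = fin j
... | ∞     = if p n then fin n else ∞

-- B^n = { x ∈ ℤ⁺ : μ(x) = n } = [2^n, 2^(n+1)), as a list
Bset : ℕ → List ℕ
Bset n = applyUpTo (λ j → 2 ^ n + j) (2 ^ n)

module Construction (W : ℕ → ℕ → ℕ → Bool) (g : ℕ → ℕ → ℕ → ℕ) where

  card : ℕ → ℕ → ℕ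
  card e s = sum (map (λ x → if W e s x then 1 else 0) (upTo s))

  F : ℕ → ℕ → ℕ → ℕ → ℕ
  F i x y s = maxUpTo (λ y' → card (g i x y') s) y

  A : ℕ → ℕ → Set
  A i x = ∀ y → ∃ λ a → LimIsℕ (λ s → F i x y s) (fin a)

  B : ℕ → ℕ → ℕ → ℕ → ℕ
  B i n y s = minList (map (λ x → F i x y s) (Bset n))

  -- I(n,y,k,s) by recursion on n; `prev n` = [I(1),…,I(n-1)]
  module _ (y k s : ℕ) where
    Icalc : ℕ → List ℕ∞ → ℕ∞
    Icalc n ps = leastBelow n (λ i → (B i n y s <ᵇ k) ∧ not (any (λ v → v ==∞ fin i) ps))

    prev : ℕ → List ℕ∞
    prev zero          = []
    prev (suc zero)    = []
    prev (suc (suc m)) = prev (suc m) ++ (Icalc (suc m) (prev (suc m)) ∷ [])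

  I : ℕ → ℕ → ℕ → ℕ → ℕ∞
  I n y k s = Icalc y k s n (prev y k s n)

Infinite : (ℕ → Set) → Set
Infinite P = ∀ N → ∃ λ x → N ≤ x × P x

-- [B(i,m,y,s) < k] is decreasing in s, increasing in k and decreasing in y, because B is
-- nondecreasing in s and in y; so, classically, its iterated limits in s, k and y exist.
-- I(n,y,k,s) is a fixed greedy assignment of indices to levels applied to this relation,
-- and its value at level n depends on only finitely many entries, so the limits pass
-- through it.  If A_i is infinite, the limit relation requests i at the levels μ(x),
-- x ∈ A_i, hence infinitely often; as only finitely many levels carry the indices below i,
-- some level beyond them that requests i must receive it.
module Submission where

open import Defs
open import Level using (0ℓ)
open import Axiom.ExcludedMiddle using (ExcludedMiddle)
open import Data.Bool using (Bool; true; false; T; not; _∧_; if_then_else_)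
open import Data.Bool.Properties using (T-≡; T-∧; T-not-≡)
open import Data.Bool.ListAction using (any)
open import Data.List using (List; []; _∷_; _++_; foldr; map; applyUpTo; upTo)
open import Data.List.Membership.Propositional using (_∈_; _∉_)
open import Data.List.Membership.Propositional.Properties
  using (∈-++⁺ˡ; ∈-++⁺ʳ; ∈-++⁻; ∈-applyUpTo⁺; ∈-map⁺)
open import Data.List.Relation.Unary.Any using (here; there)
import Data.List.Relation.Unary.Any as Any
open import Data.List.Relation.Unary.Any.Properties using (any⁺; any⁻)
open import Data.Nat
  using ( ℕ; zero; suc; _≤_; _<_; _≤′_; ≤′-step; ≤′-refl; _⊔_; _⊓_; _^_; _∸_; _+_; _<ᵇ_
        ; z≤n; s≤s; _<?_)
open import Data.Nat.Properties
open import Data.Nat.ListAction using (sum)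
open import Data.Product using (∃; _×_; _,_; proj₁; proj₂; map₁)
open import Data.Sum using (inj₁; inj₂; [_,_]′)
open import Function using (_∘_; id; Equivalence)
open import Relation.Nullary using (¬_; yes; no; contradiction)
open import Relation.Nullary.Decidable using (decidable-stable; T?)
open import Relation.Binary.Definitions using (tri<; tri≈; tri>)
open import Relation.Binary.PropositionalEquality
  using (_≡_; _≢_; refl; sym; trans; cong; cong₂; subst; subst₂)

Eventually-map : {P Q : ℕ → Set} → (∀ s → P s → Q s) → Eventually P → Eventually Q
Eventually-map f (S , p) = S , λ s S≤s → f s (p s S≤s)

Eventually-∩ : {P Q : ℕ → Set} → Eventually P → Eventually Q → Eventually (λ s → P s × Q s)
Eventually-∩ (S₁ , p) (S₂ , q) =
  S₁ ⊔ S₂ , λ s S≤s → p s (≤-trans (m≤m⊔n S₁ S₂) S≤s) , q s (≤-trans (m≤n⊔m S₁ S₂) S≤s)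

Eventually⇒∃ : {P : ℕ → Set} → Eventually P → ∃ P
Eventually⇒∃ (S , p) = S , p S ≤-refl

Eventually-∀< : (P : ℕ → ℕ → Set) → ∀ n → (∀ i → i < n → Eventually (P i)) →
                Eventually (λ s → ∀ i → i < n → P i s)
Eventually-∀< P zero _ = 0 , λ _ _ _ ()
Eventually-∀< P (suc n) ev =
  Eventually-map extend (Eventually-∩ (Eventually-∀< P n (λ i → ev i ∘ m<n⇒m<1+n)) (ev n ≤-refl))
  where
  extend : ∀ s → (∀ i → i < n → P i s) × P n s → ∀ i → i < suc n → P i s
  extend s (below , top) i i<1+n with m<1+n⇒m<n∨m≡n i<1+n
  ... | inj₁ i<n  = below i i<n
  ... | inj₂ refl = top

Eventually-persistent : {P : ℕ → Set} {s₀ : ℕ} → (∀ s → P s → P (suc s)) → P s₀ → Eventually P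
Eventually-persistent {P} {s₀} step p = s₀ , λ s s₀≤s → from (≤⇒≤′ s₀≤s)
  where
  from : ∀ {s} → s₀ ≤′ s → P s
  from ≤′-refl           = p
  from (≤′-step s₀≤′s) = step _ (from s₀≤′s)

¬T⇒T-not : ∀ {x} → ¬ T x → T (not x)
¬T⇒T-not {false} _  = _
¬T⇒T-not {true}  ¬t = ¬t _

T-not⇒¬T : ∀ {x} → T (not x) → ¬ T x
T-not⇒¬T {false} _ ()

infix 4 _⟶_

_⟶_ : (ℕ → Bool) → Bool → Set
b ⟶ v = Eventually (λ s → b s ≡ v)

Increasing : (ℕ → Bool) → Set
Increasing b = ∀ s → T (b s) → T (b (suc s))

Decreasing : (ℕ → Bool) → Set
Decreasing b = ∀ s → T (b (suc s)) → T (b s)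

⟶-T : ∀ {b v} → b ⟶ v → T v → Eventually (T ∘ b)
⟶-T conv t = Eventually-map (λ s e → subst T (sym e) t) conv

T-⟶ : ∀ {b v} → Eventually (T ∘ b) → b ⟶ v → T v
T-⟶ ev conv with Eventually⇒∃ (Eventually-∩ ev conv)
... | _ , t , e = subst T e t

⟶-mono : ∀ {b b′ u v} → (∀ s → T (b s) → T (b′ s)) → b ⟶ u → b′ ⟶ v → T u → T v
⟶-mono b⇒b′ conv conv′ t = T-⟶ (Eventually-map b⇒b′ (⟶-T conv t)) conv′

Increasing-⟶ : ∀ {b v s₀} → Increasing b → b ⟶ v → T (b s₀) → T v
Increasing-⟶ inc conv t = T-⟶ (Eventually-persistent inc t) conv

module _ (em : ExcludedMiddle 0ℓ) where

  increasing-convergent : ∀ {b} → Increasing b → ∃ (b ⟶_)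
  increasing-convergent {b} inc with em {∃ (T ∘ b)}
  ... | yes (_ , t) = true , Eventually-map (λ _ → Equivalence.to T-≡) (Eventually-persistent inc t)
  ... | no never    = false , 0 , λ s _ → Equivalence.to T-not-≡ (¬T⇒T-not (λ t → never (s , t)))

  decreasing-convergent : ∀ {b} → Decreasing b → ∃ (b ⟶_)
  decreasing-convergent {b} dec with em {∃ (¬_ ∘ T ∘ b)}
  ... | yes (_ , ¬t) =
    false , Eventually-map (λ _ → Equivalence.to T-not-≡ ∘ ¬T⇒T-not)
                           (Eventually-persistent (λ s ¬t → ¬t ∘ dec s) ¬t)
  ... | no never =
    true , 0 , λ s _ → Equivalence.to T-≡ (decidable-stable (T? (b s)) (λ ¬t → never (s , ¬t)))

leastBelow-sound : ∀ n p {j} → leastBelow n p ≡ fin j → j < n × T (p j)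
leastBelow-sound (suc n) p e with leastBelow n p in eq
leastBelow-sound (suc n) p refl | fin j = map₁ m<n⇒m<1+n (leastBelow-sound n p eq)
leastBelow-sound (suc n) p e    | ∞ with p n in pn
leastBelow-sound (suc n) p refl | ∞ | true = n<1+n n , Equivalence.from T-≡ pn

leastBelow-complete : ∀ n p {i} → T (p i) → i < n → ∃ λ j → leastBelow n p ≡ fin j × j ≤ i
leastBelow-complete (suc n) p {i} pi i<1+n with leastBelow n p in eq | m<1+n⇒m<n∨m≡n i<1+n
... | fin j | inj₂ refl = j , refl , <⇒≤ (proj₁ (leastBelow-sound n p eq))
... | fin j | inj₁ i<n
  with j′ , e , j′≤i ← leastBelow-complete n p pi i<n with refl ← trans (sym eq) e = j , refl , j′≤i
... | ∞ | inj₁ i<n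
  with j′ , e , _ ← leastBelow-complete n p pi i<n with () ← trans (sym eq) e
... | ∞ | inj₂ refl rewrite Equivalence.to T-≡ pi = i , refl , ≤-refl

leastBelow-cong : ∀ n {p q} → (∀ i → i < n → p i ≡ q i) → leastBelow n p ≡ leastBelow n q
leastBelow-cong zero    _ = refl
leastBelow-cong (suc n) {p} {q} p≗q
  with leastBelow n p | leastBelow n q | leastBelow-cong n (λ i → p≗q i ∘ m<n⇒m<1+n)
... | fin _ | _ | refl = refl
... | ∞     | _ | refl rewrite p≗q n ≤-refl = refl

fin-injective : ∀ {a b} → fin a ≡ fin b → a ≡ b
fin-injective refl = refl

any-==∞⇒∈ : ∀ {j} xs → T (any (λ v → v ==∞ fin j) xs) → fin j ∈ xs
any-==∞⇒∈ xs t = Any.map (λ {v} → sym ∘ ==∞-fin v) (any⁻ _ xs t)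
  where
  ==∞-fin : ∀ v {j} → T (v ==∞ fin j) → v ≡ fin j
  ==∞-fin (fin a) {j} t = cong fin (≡ᵇ⇒≡ a j t)

∈⇒any-==∞ : ∀ {j} xs → fin j ∈ xs → T (any (λ v → v ==∞ fin j) xs)
∈⇒any-==∞ {j} xs j∈ = any⁺ _ (Any.map (λ { refl → ≡⇒≡ᵇ j j refl }) j∈)

-- Level n is given the least index i < n such that R i n holds and i was not
-- given to an earlier level; `earlier n` lists the values of levels 1, …, n - 1.
module Assignment (R : ℕ → ℕ → Bool) where

  choose : ℕ → List ℕ∞ → ℕ∞
  choose n taken = leastBelow n (λ i → R i n ∧ not (any (λ v → v ==∞ fin i) taken))

  earlier : ℕ → List ℕ∞
  earlier zero          = []
  earlier (suc zero)    = []
  earlier (suc (suc m)) = earlier (suc m) ++ (choose (suc m) (earlier (suc m)) ∷ [])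

  assign : ℕ → ℕ∞
  assign n = choose n (earlier n)

  ∈-earlier⁺ : ∀ {m n} → 1 ≤ m → m < n → assign m ∈ earlier n
  ∈-earlier⁺ {suc _} {suc zero}      _   (s≤s ())
  ∈-earlier⁺ {m}     {suc n@(suc _)} 1≤m m<1+n =
    [ (λ m<n → ∈-++⁺ˡ (∈-earlier⁺ 1≤m m<n)) , (λ { refl → ∈-++⁺ʳ (earlier n) (here refl) }) ]′
      (m<1+n⇒m<n∨m≡n m<1+n)

  ∈-earlier⇒assigned : ∀ {v} n → v ∈ earlier n → ∃ λ m → assign m ≡ v
  ∈-earlier⇒assigned (suc n@(suc _)) v∈ =
    [ ∈-earlier⇒assigned n , (λ { (here refl) → n , refl }) ]′ (∈-++⁻ (earlier n) v∈)

  assign-sound : ∀ {n j} → assign n ≡ fin j → j < n × T (R j n) × fin j ∉ earlier n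
  assign-sound {n} e
    with j<n , t ← leastBelow-sound n _ e with r , fresh ← Equivalence.to T-∧ t =
    j<n , r , T-not⇒¬T fresh ∘ ∈⇒any-==∞ (earlier n)

  assign-complete : ∀ {n i} → T (R i n) → i < n → fin i ∉ earlier n →
                    ∃ λ j → assign n ≡ fin j × j ≤ i
  assign-complete {n} r i<n fresh =
    leastBelow-complete n _
      (Equivalence.from T-∧ (r , ¬T⇒T-not (fresh ∘ any-==∞⇒∈ (earlier n)))) i<n

  assign-fresh : ∀ {m n j} → m < n → assign m ≡ fin j → assign n ≢ fin j
  assign-fresh {m} {n} m<n e e′ =
    proj₂ (proj₂ (assign-sound {n} e′))
      (subst (_∈ earlier n) e (∈-earlier⁺ (≤-trans (s≤s z≤n) (proj₁ (assign-sound {m} e))) m<n))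

  assign-injective : ∀ {m n j} → assign m ≡ fin j → assign n ≡ fin j → m ≡ n
  assign-injective {m} {n} e e′ with <-cmp m n
  ... | tri< m<n _ _ = contradiction e′ (assign-fresh m<n e)
  ... | tri≈ _ m≡n _ = m≡n
  ... | tri> _ _ n<m = contradiction e (assign-fresh n<m e′)

  module _ (em : ExcludedMiddle 0ℓ) where

    assigned-at-bounded : ∀ j → ∃ λ M → ∀ {m} → assign m ≡ fin j → m ≤ M
    assigned-at-bounded j with em {∃ λ m → assign m ≡ fin j}
    ... | yes (m₀ , e₀) = m₀ , λ e → ≤-reflexive (assign-injective e e₀)
    ... | no never      = 0 , λ {m} e → contradiction (m , e) never

    assigned-below-bounded : ∀ i → ∃ λ N → ∀ {j m} → j < i → assign m ≡ fin j → m ≤ N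
    assigned-below-bounded zero = 0 , λ ()
    assigned-below-bounded (suc i)
      with N , below ← assigned-below-bounded i | M , at ← assigned-at-bounded i =
      N ⊔ M , λ j<1+i e →
        [ (λ j<i → ≤-trans (below j<i e) (m≤m⊔n N M))
        , (λ { refl → ≤-trans (at e) (m≤n⊔m N M) })
        ]′ (m<1+n⇒m<n∨m≡n j<1+i)

    -- A level beyond all levels holding indices below i at which i is requested
    -- must receive i itself, unless i has already been assigned.
    requested-infinitely-often⇒assigned : ∀ i → (∀ N → ∃ λ m → N < m × T (R i m)) →
                                          ∃ λ n → 1 ≤ n × assign n ≡ fin i
    requested-infinitely-often⇒assigned i often with em {∃ λ n → assign n ≡ fin i}
    ... | yes (n , e) = n , ≤-trans (s≤s z≤n) (proj₁ (assign-sound {n} e)) , e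
    ... | no never
      with N , below ← assigned-below-bounded i
      with m , N⊔i<m , r ← often (N ⊔ i)
      with j , e , j≤i ← assign-complete r (≤-<-trans (m≤n⊔m N i) N⊔i<m)
                                           (never ∘ ∈-earlier⇒assigned m)
      with m≤n⇒m<n∨m≡n j≤i
    ... | inj₁ j<i  = contradiction (below j<i e) (<⇒≱ (≤-<-trans (m≤m⊔n N i) N⊔i<m))
    ... | inj₂ refl = contradiction (m , e) never

open Assignment using (choose; earlier; assign)

AgreeUpTo : ℕ → (ℕ → ℕ → Bool) → (ℕ → ℕ → Bool) → Set
AgreeUpTo n R R′ = ∀ {i m} → i < n → m ≤ n → R i m ≡ R′ i m

AgreeUpTo-pred : ∀ {n R R′} → AgreeUpTo (suc n) R R′ → AgreeUpTo n R R′
AgreeUpTo-pred agree i<n m≤n = agree (m<n⇒m<1+n i<n) (m≤n⇒m≤1+n m≤n)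

choose-cong : ∀ {n R R′} → AgreeUpTo n R R′ → ∀ taken → choose R n taken ≡ choose R′ n taken
choose-cong {n} agree taken = leastBelow-cong n (λ i i<n → cong (_∧ _) (agree i<n ≤-refl))

earlier-cong : ∀ n {R R′} → AgreeUpTo n R R′ → earlier R n ≡ earlier R′ n
earlier-cong zero            _ = refl
earlier-cong (suc zero)      _ = refl
earlier-cong (suc n@(suc _)) {R} {R′} agree =
  cong₂ (λ xs x → xs ++ x ∷ []) (earlier-cong n agree′)
        (trans (choose-cong agree′ (earlier R n)) (cong (choose R′ n) (earlier-cong n agree′)))
  where
  agree′ : AgreeUpTo n R R′
  agree′ = AgreeUpTo-pred agree

assign-cong : ∀ {n R R′} → AgreeUpTo n R R′ → assign R n ≡ assign R′ n
assign-cong {n} {R} {R′} agree =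
  trans (choose-cong agree (earlier R n)) (cong (choose R′ n) (earlier-cong n agree))

assign-⟶ : ∀ {Rₜ : ℕ → ℕ → ℕ → Bool} {R n v} → (∀ i m → (λ t → Rₜ t i m) ⟶ R i m) →
           assign R n ≡ v → Eventually (λ t → assign (Rₜ t) n ≡ v)
assign-⟶ {Rₜ} {R} {n} conv e =
  Eventually-map (λ t box → trans (assign-cong (λ i<n m≤n → box _ i<n _ (s≤s m≤n))) e)
    (Eventually-∀< (λ i t → ∀ m → m < suc n → Rₜ t i m ≡ R i m) n
      (λ i _ → Eventually-∀< (λ m t → Rₜ t i m ≡ R i m) (suc n) (λ m _ → conv i m)))

sum-map-mono : ∀ {f g : ℕ → ℕ} xs → (∀ x → f x ≤ g x) → sum (map f xs) ≤ sum (map g xs)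
sum-map-mono []       _   = z≤n
sum-map-mono (x ∷ xs) f≤g = +-mono-≤ (f≤g x) (sum-map-mono xs f≤g)

sum-map-applyUpTo-≤-suc : ∀ (h f : ℕ → ℕ) n →
                          sum (map h (applyUpTo f n)) ≤ sum (map h (applyUpTo f (suc n)))
sum-map-applyUpTo-≤-suc h f zero    = z≤n
sum-map-applyUpTo-≤-suc h f (suc n) = +-monoʳ-≤ (h (f 0)) (sum-map-applyUpTo-≤-suc h (f ∘ suc) n)

maxUpTo-mono : ∀ {f g : ℕ → ℕ} y → (∀ y → f y ≤ g y) → maxUpTo f y ≤ maxUpTo g y
maxUpTo-mono zero    f≤g = f≤g 0
maxUpTo-mono (suc y) f≤g = ⊔-mono-≤ (maxUpTo-mono y f≤g) (f≤g (suc y))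

foldr-⊓-map-mono : ∀ {f g : ℕ → ℕ} a xs → (∀ x → f x ≤ g x) →
                   foldr _⊓_ (f a) (map f xs) ≤ foldr _⊓_ (g a) (map g xs)
foldr-⊓-map-mono a []       f≤g = f≤g a
foldr-⊓-map-mono a (x ∷ xs) f≤g = ⊓-mono-≤ (f≤g x) (foldr-⊓-map-mono a xs f≤g)

foldr-⊓-≤-init : ∀ a xs → foldr _⊓_ a xs ≤ a
foldr-⊓-≤-init a []       = ≤-refl
foldr-⊓-≤-init a (x ∷ xs) = ≤-trans (m⊓n≤n x _) (foldr-⊓-≤-init a xs)

foldr-⊓-≤-∈ : ∀ a {x xs} → x ∈ xs → foldr _⊓_ a xs ≤ x
foldr-⊓-≤-∈ a (here refl) = m⊓n≤m _ _
foldr-⊓-≤-∈ a (there x∈) = ≤-trans (m⊓n≤n _ _) (foldr-⊓-≤-∈ a x∈)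

minList-map-mono : ∀ {f g : ℕ → ℕ} xs → (∀ x → f x ≤ g x) → minList (map f xs) ≤ minList (map g xs)
minList-map-mono []       _ = z≤n
minList-map-mono (x ∷ xs) = foldr-⊓-map-mono x xs

minList-map-≤ : ∀ (f : ℕ → ℕ) {x xs} → x ∈ xs → minList (map f xs) ≤ f x
minList-map-≤ f {xs = y ∷ ys} (here refl) = foldr-⊓-≤-init (f y) (map f ys)
minList-map-≤ f {xs = y ∷ ys} (there x∈)  = foldr-⊓-≤-∈ (f y) (∈-map⁺ f x∈)

<ᵇ-mono : ∀ {a b k l} → a ≤ b → k ≤ l → T (b <ᵇ k) → T (a <ᵇ l)
<ᵇ-mono {b = b} {k} a≤b k≤l b<k = <⇒<ᵇ (≤-<-trans a≤b (<-≤-trans (<ᵇ⇒< b k b<k) k≤l))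

n<2^n : ∀ n → n < 2 ^ n
n<2^n zero    = s≤s z≤n
n<2^n (suc n) =
  +-mono-≤-< (m^n>0 2 n) (<-≤-trans (n<2^n n) (≤-reflexive (sym (+-identityʳ (2 ^ n)))))

binary-exponent : ∀ t {x} → 1 ≤ x → x < 2 ^ t → ∃ λ m → 2 ^ m ≤ x × x < 2 ^ suc m
binary-exponent zero    1≤x x<1 = contradiction 1≤x (<⇒≱ x<1)
binary-exponent (suc t) {x} 1≤x x<2^[1+t] with x <? 2 ^ t
... | yes x<2^t = binary-exponent t 1≤x x<2^t
... | no  x≮2^t = t , ≮⇒≥ x≮2^t , x<2^[1+t]

∈-Bset : ∀ m {x} → 2 ^ m ≤ x → x < 2 ^ suc m → x ∈ Bset m
∈-Bset m {x} 2^m≤x x<2^[1+m] =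
  subst (_∈ Bset m) (m+[n∸m]≡n 2^m≤x) (∈-applyUpTo⁺ (λ j → 2 ^ m + j) offset<2^m)
  where
  offset<2^m : x ∸ 2 ^ m < 2 ^ m
  offset<2^m = +-cancelˡ-< (2 ^ m) (x ∸ 2 ^ m) (2 ^ m)
    (subst₂ _<_ (sym (m+[n∸m]≡n 2^m≤x)) (cong (2 ^ m +_) (+-identityʳ (2 ^ m))) x<2^[1+m])

Bset-beyond : ∀ N {x} → 2 ^ suc N ≤ x → ∃ λ m → N < m × x ∈ Bset m
Bset-beyond N {x} 2^[1+N]≤x
  with m , 2^m≤x , x<2^[1+m] ← binary-exponent x (≤-trans (m^n>0 2 (suc N)) 2^[1+N]≤x) (n<2^n x) =
  m , N<m , ∈-Bset m 2^m≤x x<2^[1+m]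
  where
  N<m : N < m
  N<m = ≰⇒> (λ m≤N → <⇒≱ x<2^[1+m] (≤-trans (^-monoʳ-≤ 2 (s≤s m≤N)) 2^[1+N]≤x))

module Limits (em : ExcludedMiddle 0ℓ) (W : ℕ → ℕ → ℕ → Bool) (st : IsStageApprox W)
              (g : ℕ → ℕ → ℕ → ℕ) where
  open Construction W g

  card-mono : ∀ e s → card e s ≤ card e (suc s)
  card-mono e s =
    ≤-trans (sum-map-mono (upTo s) indicator-mono) (sum-map-applyUpTo-≤-suc _ id s)
    where
    indicator-mono : ∀ x → (if W e s x then 1 else 0) ≤ (if W e (suc s) x then 1 else 0)
    indicator-mono x with W e s x in x∈
    ... | false = z≤n
    ... | true rewrite IsStageApprox.mono st e s x x∈ = ≤-refl

  B-monoˢ : ∀ i m y s → B i m y s ≤ B i m y (suc s)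
  B-monoˢ i m y s =
    minList-map-mono (Bset m) (λ x → maxUpTo-mono y (λ y′ → card-mono (g i x y′) s))

  B-monoʸ : ∀ i m y s → B i m y s ≤ B i m (suc y) s
  B-monoʸ i m y s = minList-map-mono (Bset m) (λ x → m≤m⊔n _ _)

  -- smallB y k s i m is [B(i,m,y,s) < k]; each subscript added to the name
  -- records a variable that has been sent to its limit.
  smallB : ℕ → ℕ → ℕ → ℕ → ℕ → Bool
  smallB y k s i m = B i m y s <ᵇ k

  smallBₛ-conv : ∀ y k i m → ∃ ((λ s → smallB y k s i m) ⟶_)
  smallBₛ-conv y k i m =
    decreasing-convergent em (λ s → <ᵇ-mono {k = k} (B-monoˢ i m y s) ≤-refl)

  smallBₛ : ℕ → ℕ → ℕ → ℕ → Bool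
  smallBₛ y k i m = proj₁ (smallBₛ-conv y k i m)

  smallBₛ-increasingₖ : ∀ y i m → Increasing (λ k → smallBₛ y k i m)
  smallBₛ-increasingₖ y i m k =
    ⟶-mono (λ s → <ᵇ-mono {a = B i m y s} ≤-refl (n≤1+n k))
           (proj₂ (smallBₛ-conv y k i m)) (proj₂ (smallBₛ-conv y (suc k) i m))

  smallBₛₖ-conv : ∀ y i m → ∃ ((λ k → smallBₛ y k i m) ⟶_)
  smallBₛₖ-conv y i m = increasing-convergent em (smallBₛ-increasingₖ y i m)

  smallBₛₖ : ℕ → ℕ → ℕ → Bool
  smallBₛₖ y i m = proj₁ (smallBₛₖ-conv y i m)

  smallBₛₖ-decreasingʸ : ∀ i m → Decreasing (λ y → smallBₛₖ y i m)
  smallBₛₖ-decreasingʸ i m y =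
    ⟶-mono smallBₛ-decreasingʸ (proj₂ (smallBₛₖ-conv (suc y) i m)) (proj₂ (smallBₛₖ-conv y i m))
    where
    smallBₛ-decreasingʸ : ∀ k → T (smallBₛ (suc y) k i m) → T (smallBₛ y k i m)
    smallBₛ-decreasingʸ k =
      ⟶-mono (λ s → <ᵇ-mono {k = k} (B-monoʸ i m y s) ≤-refl)
             (proj₂ (smallBₛ-conv (suc y) k i m)) (proj₂ (smallBₛ-conv y k i m))

  smallBₛₖᵧ-conv : ∀ i m → ∃ ((λ y → smallBₛₖ y i m) ⟶_)
  smallBₛₖᵧ-conv i m = decreasing-convergent em (smallBₛₖ-decreasingʸ i m)

  smallBₛₖᵧ : ℕ → ℕ → Bool
  smallBₛₖᵧ i m = proj₁ (smallBₛₖᵧ-conv i m)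

  -- Once k exceeds lim_s F(i,x,y,s), we have B(i,m,y,s) < k for all large s.
  smallBₛₖ-Bset-A : ∀ {i m x} → x ∈ Bset m → A i x → ∀ y → T (smallBₛₖ y i m)
  smallBₛₖ-Bset-A {i} {m} {x} x∈Bᵐ x∈A y = at-limit (x∈A y)
    where
    at-limit : (∃ λ a → LimIsℕ (λ s → F i x y s) (fin a)) → T (smallBₛₖ y i m)
    at-limit (a , F⟶a) =
      Increasing-⟶ {s₀ = suc a} (smallBₛ-increasingₖ y i m) (proj₂ (smallBₛₖ-conv y i m))
        (T-⟶ {b = λ s → smallB y (suc a) s i m} (Eventually-map B<1+a F⟶a)
             (proj₂ (smallBₛ-conv y (suc a) i m)))
      where
      B<1+a : ∀ s → fin (F i x y s) ≡ fin a → T (smallB y (suc a) s i m)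
      B<1+a s F≡a = <⇒<ᵇ (s≤s (subst (B i m y s ≤_) (fin-injective F≡a)
                                     (minList-map-≤ (λ x → F i x y s) x∈Bᵐ)))

  smallBₛₖᵧ-infinitely-often : ∀ {i} → Infinite (A i) → ∀ N → ∃ λ m → N < m × T (smallBₛₖᵧ i m)
  smallBₛₖᵧ-infinitely-often {i} inf N = beyond (inf (2 ^ suc N))
    where
    beyond : (∃ λ x → 2 ^ suc N ≤ x × A i x) → ∃ λ m → N < m × T (smallBₛₖᵧ i m)
    beyond (x , 2^[1+N]≤x , x∈A) =
      let m , N<m , x∈Bᵐ = Bset-beyond N 2^[1+N]≤x
      in m , N<m , T-⟶ {b = λ y → smallBₛₖ y i m} (0 , λ y _ → smallBₛₖ-Bset-A {i} {m} x∈Bᵐ x∈A y)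
                       (proj₂ (smallBₛₖᵧ-conv i m))

  earlier≡prev : ∀ y k s n → earlier (smallB y k s) n ≡ prev y k s n
  earlier≡prev y k s zero          = refl
  earlier≡prev y k s (suc zero)    = refl
  earlier≡prev y k s (suc (suc n)) =
    cong (λ xs → xs ++ (Icalc y k s (suc n) xs ∷ [])) (earlier≡prev y k s (suc n))

  I≡assign : ∀ n y k s → I n y k s ≡ assign (smallB y k s) n
  I≡assign n y k s = cong (Icalc y k s n) (sym (earlier≡prev y k s n))

  I-⟶ : ∀ {n j} → assign smallBₛₖᵧ n ≡ fin j →
        Eventually (λ y → Eventually (λ k → LimIs (λ s → I n y k s) (fin j)))
  I-⟶ {n} assigned =
    Eventually-map
      (λ y → Eventually-map (λ k → Eventually-map (λ s → trans (I≡assign n y k s)) ∘ limₛ y k)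
             ∘ limₖ y)
      (limᵧ assigned)
    where
    limᵧ : ∀ {v} → assign smallBₛₖᵧ n ≡ v → Eventually (λ y → assign (smallBₛₖ y) n ≡ v)
    limᵧ = assign-⟶ {smallBₛₖ} {smallBₛₖᵧ} {n} (λ i m → proj₂ (smallBₛₖᵧ-conv i m))
    limₖ : ∀ y {v} → assign (smallBₛₖ y) n ≡ v → Eventually (λ k → assign (smallBₛ y k) n ≡ v)
    limₖ y = assign-⟶ {λ k → smallBₛ y k} {smallBₛₖ y} {n}
                      (λ i m → proj₂ (smallBₛₖ-conv y i m))
    limₛ : ∀ y k {v} → assign (smallBₛ y k) n ≡ v →
           Eventually (λ s → assign (smallB y k s) n ≡ v)
    limₛ y k = assign-⟶ {λ s → smallB y k s} {smallBₛ y k} {n}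
                        (λ i m → proj₂ (smallBₛ-conv y k i m))

mainTheorem14 : ExcludedMiddle 0ℓ →
    (W : ℕ → ℕ → ℕ → Bool) → IsStageApprox W →
    (g : ℕ → ℕ → ℕ → ℕ) →
    (i : ℕ) → Infinite (Construction.A W g i) →
    ∃ λ n → 1 ≤ n ×
      Eventually (λ y → Eventually (λ k →
        LimIs (λ s → Construction.I W g n y k s) (fin i)))
mainTheorem14 em W st g i infinite =
  let n , 1≤n , assigned = Assignment.requested-infinitely-often⇒assigned smallBₛₖᵧ em i
                             (smallBₛₖᵧ-infinitely-often {i} infinite)
  in n , 1≤n , I-⟶ {n} assigned
  where open Limits em W st g
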